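{- Let $d$ be a positive integer and $\mathcal D$ a Ferrers diagram of order $n$ such that $\mathcal D\cap\mathcal B_{n,d-1}\ne\emptyset$ and $(\mathcal D,d)$ is in $(a,b)$-standard form, with $X=X(\mathcal D,d)$, $Y=Y(\mathcal D,d)$. Then for all $i\in[d-1]$, $$\nu_i(\mathcal D,d)-\nu_{i-1}(\mathcal D,d)=b-a+d-2i+c_{d-i}(X)-c_i(Y),$$ and for all $j\in[d-1]$, $$\nu_j(\mathcal D,d)-\nu_0(\mathcal D,d)=j(b-a+d-1-j)+\sum_{i=1}^{j}c_{d-i}(X)-\sum_{i=1}^{j}c_i(Y).$$
   Context: $\mathbb N=\{1,2,\dots\}$, $[m]=\{1,\dots,m\}$. A Ferrers diagram is a finite $\mathcal D\subseteq\mathbb N^2$ with $(x,y)\in\mathcal D\Rightarrow(i,j)\in\mathcal D$ for all $i\in[x]$, $j\in[y]$ (row, column); order $n$ means $\mathcal D\subseteq[n]^2$. $\nu_j(\mathcal D,d)=|\{(x,y)\in\mathcal D:x\ge d-j,\ y\ge j+1\}|$ for $0\le j\le d-1$. $\mathcal B_{n,d-1}=\{d-1,\dots,n\}^2$. $(\mathcal D,d)$ is in $(a,b)$-standard form (integers $a,b\ge d-1$) if $\mathcal D\cap\mathcal B_{n,d-1}=\{d-1,\dots,a\}\times\{d-1,\dots,b\}$; then $X(\mathcal D,d)=\{(y,x):(x,y)\in\mathcal D,\ x\in[d-2],\ y\ge b+1\}$ and $Y(\mathcal D,d)=\{(x,y)\in\mathcal D:x\ge a+1,\ y\in[d-2]\}$.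 For finite $Z\subseteq\mathbb N^2$, $c_i(Z)=|Z\cap(\mathbb N\times\{i\})|$ (so $c_{d-1}(X)=c_{d-1}(Y)=0$). -}

module Defs where

open import Data.Nat using (ℕ; zero; suc; _+_; _*_; _∸_; _≤_; _≤ᵇ_; _≡ᵇ_)
open import Data.Bool using (Bool; true; false; _∧_; if_then_else_)
open import Data.List using (List; map; upTo)
open import Data.Nat.ListAction using (sum)
open import Data.Product using (_×_; ∃; ∃-syntax; Σ)
open import Function.Bundles using (_⇔_)
open import Relation.Binary.PropositionalEquality using (_≡_)

-- A subset of ℕ² (ℕ here includes 0, but diagrams live in ℕ₊²) is a
-- Boolean-valued predicate; (x , y) = (row , column).
Subset² : Set
Subset² = ℕ → ℕ → Bool

[_] : ℕ → List ℕ
[ m ] = map suc (upTo m)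

[0…_] : ℕ → List ℕ
[0… m ] = upTo (suc m)

count : List ℕ → (ℕ → Bool) → ℕ
count xs P = sum (map (λ x → if P x then 1 else 0) xs)

IsFerrers : ℕ → Subset² → Set
IsFerrers n D =
  (∀ x y → D x y ≡ true → (1 ≤ x × x ≤ n) × (1 ≤ y × y ≤ n)) ×
  (∀ x y i j → D x y ≡ true → 1 ≤ i → i ≤ x → 1 ≤ j → j ≤ y → D i j ≡ true)

-- ν_j(D,d) = |{(x,y) ∈ D : x ≥ d - j, y ≥ j + 1}|  (D ⊆ [n]², so counting over [n]² suffices)
ν : ℕ → Subset² → ℕ → ℕ → ℕ
ν n D d j = sum (map (λ x → count [ n ] (λ y → D x y ∧ ((d ∸ j) ≤ᵇ x) ∧ (suc j ≤ᵇ y))) [ n ])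

MeetsB : ℕ → Subset² → ℕ → Set
MeetsB n D d = ∃[ x ] ∃[ y ] (D x y ≡ true × ((d ∸ 1 ≤ x × x ≤ n) × (d ∸ 1 ≤ y × y ≤ n)))

StandardForm : ℕ → Subset² → ℕ → ℕ → ℕ → Set
StandardForm n D d a b =
  (d ∸ 1 ≤ a) × (d ∸ 1 ≤ b) ×
  (∀ x y → (D x y ≡ true × ((d ∸ 1 ≤ x × x ≤ n) × (d ∸ 1 ≤ y × y ≤ n)))
           ⇔ ((d ∸ 1 ≤ x × x ≤ a) × (d ∸ 1 ≤ y × y ≤ b)))

Xset : Subset² → ℕ → ℕ → Subset²
Xset D d b p q = D q p ∧ (1 ≤ᵇ q) ∧ (q ≤ᵇ (d ∸ 2)) ∧ (suc b ≤ᵇ p)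

Yset : Subset² → ℕ → ℕ → Subset²
Yset D d a p q = D p q ∧ (suc a ≤ᵇ p) ∧ (1 ≤ᵇ q) ∧ (q ≤ᵇ (d ∸ 2))

-- c_i(Z) = |Z ∩ (ℕ × {i})|, for Z whose first coordinates lie in {0,…,N}
c : ℕ → ℕ → Subset² → ℕ
c N i Z = count [0… N ] (λ p → Z p i)

-- With r = d − i, ν_i counts the cells (x, y) of D with x ≥ r, y > i and ν_{i−1} those with
-- x > r, y ≥ i. Both are the quadrant x > r, y > i plus a segment next to the corner (r, i): row r
-- beyond column i, resp. column i below row r. Hence
-- ν_i + #{x > r : (x, i) ∈ D} = ν_{i−1} + #{y > i : (r, y) ∈ D}. In standard form the
-- row segment first crosses the full rectangle [a] × [b] (b − i cells) and beyond column b it is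
-- counted by c_r(X): for r ≤ d − 2 by definition of X, and for r = d − 1 both are empty. The column
-- segment is symmetrically (a − r) + c_i(Y). The second identity is the first one telescoped.

module Submission where

open import Data.Bool using (Bool; true; false; _∧_; if_then_else_)
open import Data.Bool.Properties using (T-≡)
open import Data.List using (List; []; _∷_; _++_; map; upTo)
open import Data.List.Properties using (map-cong; map-++; map-upTo; upTo-∷ʳ)
open import Data.Nat.ListAction using (sum)
open import Data.Nat.ListAction.Properties using (sum-++)
open import Data.Product using (_×_; _,_; proj₁; proj₂)
open import Function.Bundles using (Equivalence)
open import Relation.Nullary using (¬_; contradiction; yes; no)
open import Relation.Binary.PropositionalEquality
  using (_≡_; refl; sym; trans; cong; cong₂; module ≡-Reasoning)

open import Defs

module Counting where
  open import Data.Nat using (ℕ; zero; suc; _+_; _*_; _∸_; _≤_; _<_; _≤ᵇ_; _≤?_; z≤n; s≤s; z<s)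
  open import Data.Nat.Properties
    using ( ≤-refl; ≤-trans; ≤-reflexive; <-trans; <⇒≤; <⇒≱; ≰⇒>; n<1+n; m≤m+n; m≤n⇒m≤1+n
          ; m≤n⇒m<n∨m≡n; ≤⇒≤ᵇ; ≤ᵇ⇒≤; m<n⇒0<n∸m; ∸-monoʳ-≤; +-∸-assoc; m+[n∸m]≡n
          ; +-identityʳ; +-assoc; +-suc; *-identityˡ; *-zeroʳ; *-distribˡ-+
          ; +-commutativeSemigroup; *-commutativeSemigroup )
  import Algebra.Properties.CommutativeSemigroup +-commutativeSemigroup as +-CS
  import Algebra.Properties.CommutativeSemigroup *-commutativeSemigroup as *-CS
  open import Data.Sum using (inj₁; inj₂)
  open ≡-Reasoning

  𝟙 : Bool → ℕ
  𝟙 b = if b then 1 else 0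

  𝟙-∧ : ∀ a b → 𝟙 (a ∧ b) ≡ 𝟙 a * 𝟙 b
  𝟙-∧ false b = refl
  𝟙-∧ true  b = sym (+-identityʳ (𝟙 b))

  𝟙-∧³ : ∀ a b c → 𝟙 (a ∧ b ∧ c) ≡ 𝟙 a * (𝟙 b * 𝟙 c)
  𝟙-∧³ a b c = trans (𝟙-∧ a (b ∧ c)) (cong (𝟙 a *_) (𝟙-∧ b c))

  𝟙-false : ∀ {b} → ¬ (b ≡ true) → 𝟙 b ≡ 0
  𝟙-false {false} _   = refl
  𝟙-false {true}  b≢t = contradiction refl b≢t

  ≤ᵇ-true : ∀ {m n} → m ≤ n → (m ≤ᵇ n) ≡ true
  ≤ᵇ-true m≤n = Equivalence.to T-≡ (≤⇒≤ᵇ m≤n)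

  𝟙-≤ᵇ : ∀ {m n} → m ≤ n → 𝟙 (m ≤ᵇ n) ≡ 1
  𝟙-≤ᵇ m≤n = cong 𝟙 (≤ᵇ-true m≤n)

  𝟙-≰ᵇ : ∀ {m n} → n < m → 𝟙 (m ≤ᵇ n) ≡ 0
  𝟙-≰ᵇ {m} {n} n<m = 𝟙-false (λ e → <⇒≱ n<m (≤ᵇ⇒≤ m n (Equivalence.from T-≡ e)))

  𝟙-≤ᵇ-mask : ∀ {x m} t → (¬ x ≤ m → t ≡ 0) → t ≡ 𝟙 (x ≤ᵇ m) * t
  𝟙-≤ᵇ-mask {x} {m} t vanish with x ≤? m
  ... | yes x≤m = sym (trans (cong (_* t) (𝟙-≤ᵇ x≤m)) (*-identityˡ t))
  ... | no  x≰m = trans (vanish x≰m) (cong (_* t) (sym (𝟙-≰ᵇ (≰⇒> x≰m))))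

  m≤n∸1⇒m<n : ∀ {m n} → 1 ≤ m → m ≤ n ∸ 1 → m < n
  m≤n∸1⇒m<n {n = zero}  1≤m m≤0 = contradiction (≤-trans 1≤m m≤0) λ ()
  m≤n∸1⇒m<n {n = suc n} _   m≤n = s≤s m≤n

  m∸2<n⇒m∸1≤n : ∀ m {n} → m ∸ 2 < n → m ∸ 1 ≤ n
  m∸2<n⇒m∸1≤n zero          _ = z≤n
  m∸2<n⇒m∸1≤n (suc zero)    _ = z≤n
  m∸2<n⇒m∸1≤n (suc (suc m)) p = p

  ∑ : List ℕ → (ℕ → ℕ) → ℕ
  ∑ xs f = sum (map f xs)

  infix 5 ∑
  syntax ∑ xs (λ x → e) = ∑[ x ∈ xs ] e

  ∑-cong : ∀ xs {f g : ℕ → ℕ} → (∀ x → f x ≡ g x) → ∑ xs f ≡ ∑ xs g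
  ∑-cong xs f≗g = cong sum (map-cong f≗g xs)

  ∑-distrib-+ : ∀ xs (f g : ℕ → ℕ) → (∑[ x ∈ xs ] f x + g x) ≡ ∑ xs f + ∑ xs g
  ∑-distrib-+ []       f g = refl
  ∑-distrib-+ (x ∷ xs) f g =
    trans (cong (f x + g x +_) (∑-distrib-+ xs f g)) (+-CS.interchange (f x) (g x) (∑ xs f) (∑ xs g))

  *-distribˡ-∑ : ∀ k xs (f : ℕ → ℕ) → k * ∑ xs f ≡ (∑[ x ∈ xs ] k * f x)
  *-distribˡ-∑ k []       f = *-zeroʳ k
  *-distribˡ-∑ k (x ∷ xs) f =
    trans (*-distribˡ-+ k (f x) (∑ xs f)) (cong (k * f x +_) (*-distribˡ-∑ k xs f))

  ∑-[0…] : ∀ n f → ∑ [0… n ] f ≡ f 0 + ∑ [ n ] f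
  ∑-[0…] n f = cong (λ xs → f 0 + ∑ xs f) (sym (map-upTo suc n))

  ∑-[suc] : ∀ n f → ∑ [ suc n ] f ≡ ∑ [ n ] f + f (suc n)
  ∑-[suc] n f = begin
    ∑ (map suc (upTo (suc n))) f          ≡⟨ cong (λ xs → ∑ (map suc xs) f) (sym (upTo-∷ʳ n)) ⟩
    ∑ (map suc (upTo n ++ n ∷ [])) f      ≡⟨ cong (λ xs → ∑ xs f) (map-++ suc (upTo n) (n ∷ [])) ⟩
    ∑ ([ n ] ++ suc n ∷ []) f             ≡⟨ cong sum (map-++ f [ n ] (suc n ∷ [])) ⟩
    sum (map f [ n ] ++ f (suc n) ∷ [])   ≡⟨ sum-++ (map f [ n ]) (f (suc n) ∷ []) ⟩
    ∑ [ n ] f + (f (suc n) + 0)           ≡⟨ cong (∑ [ n ] f +_) (+-identityʳ (f (suc n))) ⟩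
    ∑ [ n ] f + f (suc n)                 ∎

  ∑from : ℕ → ℕ → (ℕ → ℕ) → ℕ
  ∑from n k f = ∑[ y ∈ [ n ] ] 𝟙 (k ≤ᵇ y) * f y

  ∑from-cong : ∀ n k {f g : ℕ → ℕ} → (∀ y → f y ≡ g y) → ∑from n k f ≡ ∑from n k g
  ∑from-cong n k f≗g = ∑-cong [ n ] (λ y → cong (𝟙 (k ≤ᵇ y) *_) (f≗g y))

  ∑from-distrib-+ : ∀ n k (f g : ℕ → ℕ) → ∑from n k (λ y → f y + g y) ≡ ∑from n k f + ∑from n k g
  ∑from-distrib-+ n k f g =
    trans (∑-cong [ n ] (λ y → *-distribˡ-+ (𝟙 (k ≤ᵇ y)) (f y) (g y)))
          (∑-distrib-+ [ n ] (λ y → 𝟙 (k ≤ᵇ y) * f y) (λ y → 𝟙 (k ≤ᵇ y) * g y))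

  ∑from-[0…] : ∀ n k f → (∑[ y ∈ [0… n ] ] 𝟙 (suc k ≤ᵇ y) * f y) ≡ ∑from n (suc k) f
  ∑from-[0…] n k f =
    trans (∑-[0…] n (λ y → 𝟙 (suc k ≤ᵇ y) * f y)) (cong (λ t → t * f 0 + ∑from n (suc k) f) (𝟙-≰ᵇ {suc k} z<s))

  ∑from-suc : ∀ n k f → ∑from (suc n) k f ≡ ∑from n k f + 𝟙 (k ≤ᵇ suc n) * f (suc n)
  ∑from-suc n k f = ∑-[suc] n (λ y → 𝟙 (k ≤ᵇ y) * f y)

  ∑from-vanish : ∀ n {k} f → (∀ y → k ≤ y → y ≤ n → f y ≡ 0) → ∑from n k f ≡ 0
  ∑from-vanish zero    f _   = refl
  ∑from-vanish (suc n) {k} f f≡0 = begin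
    ∑from (suc n) k f                           ≡⟨ ∑from-suc n k f ⟩
    ∑from n k f + 𝟙 (k ≤ᵇ suc n) * f (suc n)    ≡⟨ cong₂ _+_ earlier last ⟩
    0                                           ∎
    where
    earlier : ∑from n k f ≡ 0
    earlier = ∑from-vanish n f (λ y k≤y y≤n → f≡0 y k≤y (m≤n⇒m≤1+n y≤n))
    last : 𝟙 (k ≤ᵇ suc n) * f (suc n) ≡ 0
    last with k ≤? suc n
    ... | yes k≤1+n = trans (cong (𝟙 (k ≤ᵇ suc n) *_) (f≡0 (suc n) k≤1+n ≤-refl)) (*-zeroʳ (𝟙 (k ≤ᵇ suc n)))
    ... | no  k≰1+n = cong (_* f (suc n)) (𝟙-≰ᵇ (≰⇒> k≰1+n))

  ∑from-beyond : ∀ n {k} f → n < k → ∑from n k f ≡ 0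
  ∑from-beyond n f n<k = ∑from-vanish n f (λ y k≤y y≤n → contradiction (≤-trans k≤y y≤n) (<⇒≱ n<k))

  ∑from-peel : ∀ n {k} f → 1 ≤ k → k ≤ n → ∑from n k f ≡ f k + ∑from n (suc k) f
  ∑from-peel zero    f 1≤k k≤0 = contradiction (≤-trans 1≤k k≤0) λ ()
  ∑from-peel (suc n) {k} f 1≤k k≤1+n with m≤n⇒m<n∨m≡n k≤1+n
  ... | inj₁ (s≤s k≤n) = begin
    ∑from (suc n) k f                                              ≡⟨ ∑from-suc n k f ⟩
    ∑from n k f + 𝟙 (k ≤ᵇ suc n) * f (suc n)                       ≡⟨ cong₂ _+_ (∑from-peel n f 1≤k k≤n) last ⟩
    f k + ∑from n (suc k) f + 𝟙 (suc k ≤ᵇ suc n) * f (suc n)       ≡⟨ +-assoc (f k) _ _ ⟩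
    f k + (∑from n (suc k) f + 𝟙 (suc k ≤ᵇ suc n) * f (suc n))     ≡⟨ cong (f k +_) (∑from-suc n (suc k) f) ⟨
    f k + ∑from (suc n) (suc k) f                                  ∎
    where
    last : 𝟙 (k ≤ᵇ suc n) * f (suc n) ≡ 𝟙 (suc k ≤ᵇ suc n) * f (suc n)
    last = cong (_* f (suc n)) (trans (𝟙-≤ᵇ (m≤n⇒m≤1+n k≤n)) (sym (𝟙-≤ᵇ (s≤s k≤n))))
  ... | inj₂ refl = begin
    ∑from (suc n) (suc n) f                                 ≡⟨ ∑from-suc n (suc n) f ⟩
    ∑from n (suc n) f + 𝟙 (suc n ≤ᵇ suc n) * f (suc n)      ≡⟨ cong₂ _+_ (∑from-beyond n f ≤-refl) last ⟩
    f (suc n)                                               ≡⟨ +-identityʳ (f (suc n)) ⟨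
    f (suc n) + 0                                           ≡⟨ cong (f (suc n) +_) (∑from-beyond (suc n) f ≤-refl) ⟨
    f (suc n) + ∑from (suc n) (suc (suc n)) f               ∎
    where
    last : 𝟙 (suc n ≤ᵇ suc n) * f (suc n) ≡ f (suc n)
    last = trans (cong (_* f (suc n)) (𝟙-≤ᵇ (≤-refl {suc n}))) (*-identityˡ (f (suc n)))

  ∑from-ones : ∀ n {k} l f → k + l ≤ n → (∀ y → k < y → y ≤ k + l → f y ≡ 1) →
               ∑from n (suc k) f ≡ l + ∑from n (suc (k + l)) f
  ∑from-ones n {k} zero    f _ _ = cong (λ m → ∑from n (suc m) f) (sym (+-identityʳ k))
  ∑from-ones n {k} (suc l) f k+1+l≤n ones = begin
    ∑from n (suc k) f                          ≡⟨ ∑from-peel n f (s≤s z≤n) (≤-trans (s≤s (m≤m+n k l)) bound) ⟩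
    f (suc k) + ∑from n (suc (suc k)) f        ≡⟨ cong₂ _+_ (ones (suc k) ≤-refl (≤-trans (s≤s (m≤m+n k l)) shift)) rest ⟩
    suc (l + ∑from n (suc (suc (k + l))) f)    ≡⟨ cong (λ m → suc (l + ∑from n (suc m) f)) (+-suc k l) ⟨
    suc l + ∑from n (suc (k + suc l)) f        ∎
    where
    shift : suc (k + l) ≤ k + suc l
    shift = ≤-reflexive (sym (+-suc k l))
    bound : suc (k + l) ≤ n
    bound = ≤-trans shift k+1+l≤n
    rest : ∑from n (suc (suc k)) f ≡ l + ∑from n (suc (suc (k + l))) f
    rest = ∑from-ones n l f bound (λ y 1+k<y y≤ → ones y (<-trans (n<1+n k) 1+k<y) (≤-trans y≤ shift))

  ∑from-run : ∀ n {k m} f → k ≤ m → m ≤ n → (∀ y → k < y → y ≤ m → f y ≡ 1) →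
              ∑from n (suc k) f ≡ (m ∸ k) + ∑from n (suc m) f
  ∑from-run n {k} {m} f k≤m m≤n ones = begin
    ∑from n (suc k) f                              ≡⟨ ∑from-ones n (m ∸ k) f (≤-trans (≤-reflexive k+[m∸k]≡m) m≤n)
                                                        (λ y k<y y≤ → ones y k<y (≤-trans y≤ (≤-reflexive k+[m∸k]≡m))) ⟩
    (m ∸ k) + ∑from n (suc (k + (m ∸ k))) f        ≡⟨ cong (λ t → (m ∸ k) + ∑from n (suc t) f) k+[m∸k]≡m ⟩
    (m ∸ k) + ∑from n (suc m) f                    ∎
    where
    k+[m∸k]≡m : k + (m ∸ k) ≡ m
    k+[m∸k]≡m = m+[n∸m]≡n k≤m

  rowTail : ℕ → Subset² → ℕ → ℕ → ℕ
  rowTail n D x k = ∑from n k (λ y → 𝟙 (D x y))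

  colTail : ℕ → Subset² → ℕ → ℕ → ℕ
  colTail n D y r = ∑from n r (λ x → 𝟙 (D x y))

  quadrant : ℕ → Subset² → ℕ → ℕ → ℕ
  quadrant n D r k = ∑from n r (λ x → rowTail n D x k)

  ν≡quadrant : ∀ n D d j → ν n D d j ≡ quadrant n D (d ∸ j) (suc j)
  ν≡quadrant n D d j = ∑-cong [ n ] λ x → begin
    count [ n ] (λ y → D x y ∧ (d ∸ j ≤ᵇ x) ∧ (suc j ≤ᵇ y))
      ≡⟨ ∑-cong [ n ] (λ y → trans (𝟙-∧³ (D x y) (d ∸ j ≤ᵇ x) (suc j ≤ᵇ y))
                                         (*-CS.x∙yz≈y∙zx (𝟙 (D x y)) (𝟙 (d ∸ j ≤ᵇ x)) (𝟙 (suc j ≤ᵇ y)))) ⟩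
    (∑[ y ∈ [ n ] ] 𝟙 (d ∸ j ≤ᵇ x) * (𝟙 (suc j ≤ᵇ y) * 𝟙 (D x y)))
      ≡⟨ *-distribˡ-∑ (𝟙 (d ∸ j ≤ᵇ x)) [ n ] (λ y → 𝟙 (suc j ≤ᵇ y) * 𝟙 (D x y)) ⟨
    𝟙 (d ∸ j ≤ᵇ x) * rowTail n D x (suc j)
      ∎

  quadrant-corner : ∀ n D {r k} → 1 ≤ r → r ≤ n → 1 ≤ k → k ≤ n →
    quadrant n D r (suc k) + colTail n D k (suc r) ≡ quadrant n D (suc r) k + rowTail n D r (suc k)
  quadrant-corner n D {r} {k} 1≤r r≤n 1≤k k≤n = begin
    quadrant n D r (suc k) + colTail n D k (suc r)
      ≡⟨ cong (_+ colTail n D k (suc r)) (∑from-peel n (λ x → rowTail n D x (suc k)) 1≤r r≤n) ⟩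
    rowTail n D r (suc k) + quadrant n D (suc r) (suc k) + colTail n D k (suc r)
      ≡⟨ +-CS.xy∙z≈zy∙x (rowTail n D r (suc k)) (quadrant n D (suc r) (suc k)) (colTail n D k (suc r)) ⟩
    colTail n D k (suc r) + quadrant n D (suc r) (suc k) + rowTail n D r (suc k)
      ≡⟨ cong (_+ rowTail n D r (suc k)) peelColumn ⟨
    quadrant n D (suc r) k + rowTail n D r (suc k)
      ∎
    where
    peelColumn : quadrant n D (suc r) k ≡ colTail n D k (suc r) + quadrant n D (suc r) (suc k)
    peelColumn = trans (∑from-cong n (suc r) (λ x → ∑from-peel n (λ y → 𝟙 (D x y)) 1≤k k≤n))
                       (∑from-distrib-+ n (suc r) (λ x → 𝟙 (D x k)) (λ x → rowTail n D x (suc k)))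

  c-Xset : ∀ n D {d b r} → 1 ≤ r → c n r (Xset D d b) ≡ 𝟙 (r ≤ᵇ d ∸ 2) * rowTail n D r (suc b)
  c-Xset n D {d} {b} {r} 1≤r = begin
    c n r (Xset D d b)
      ≡⟨ ∑-cong [0… n ] pointwise ⟩
    (∑[ p ∈ [0… n ] ] 𝟙 (r ≤ᵇ d ∸ 2) * (𝟙 (suc b ≤ᵇ p) * 𝟙 (D r p)))
      ≡⟨ *-distribˡ-∑ (𝟙 (r ≤ᵇ d ∸ 2)) [0… n ] (λ p → 𝟙 (suc b ≤ᵇ p) * 𝟙 (D r p)) ⟨
    𝟙 (r ≤ᵇ d ∸ 2) * (∑[ p ∈ [0… n ] ] 𝟙 (suc b ≤ᵇ p) * 𝟙 (D r p))
      ≡⟨ cong (𝟙 (r ≤ᵇ d ∸ 2) *_) (∑from-[0…] n b (λ p → 𝟙 (D r p))) ⟩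
    𝟙 (r ≤ᵇ d ∸ 2) * rowTail n D r (suc b)
      ∎
    where
    pointwise : ∀ p → 𝟙 (D r p ∧ (1 ≤ᵇ r) ∧ (r ≤ᵇ d ∸ 2) ∧ (suc b ≤ᵇ p))
                      ≡ 𝟙 (r ≤ᵇ d ∸ 2) * (𝟙 (suc b ≤ᵇ p) * 𝟙 (D r p))
    pointwise p = begin
      𝟙 (D r p ∧ (1 ≤ᵇ r) ∧ (r ≤ᵇ d ∸ 2) ∧ (suc b ≤ᵇ p))
        ≡⟨ cong (λ t → 𝟙 (D r p ∧ t ∧ (r ≤ᵇ d ∸ 2) ∧ (suc b ≤ᵇ p))) (≤ᵇ-true 1≤r) ⟩
      𝟙 (D r p ∧ (r ≤ᵇ d ∸ 2) ∧ (suc b ≤ᵇ p))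
        ≡⟨ 𝟙-∧³ (D r p) (r ≤ᵇ d ∸ 2) (suc b ≤ᵇ p) ⟩
      𝟙 (D r p) * (𝟙 (r ≤ᵇ d ∸ 2) * 𝟙 (suc b ≤ᵇ p))
        ≡⟨ *-CS.x∙yz≈y∙zx (𝟙 (D r p)) (𝟙 (r ≤ᵇ d ∸ 2)) (𝟙 (suc b ≤ᵇ p)) ⟩
      𝟙 (r ≤ᵇ d ∸ 2) * (𝟙 (suc b ≤ᵇ p) * 𝟙 (D r p))
        ∎

  c-Yset : ∀ n D {d a i} → 1 ≤ i → c n i (Yset D d a) ≡ 𝟙 (i ≤ᵇ d ∸ 2) * colTail n D i (suc a)
  c-Yset n D {d} {a} {i} 1≤i = begin
    c n i (Yset D d a)
      ≡⟨ ∑-cong [0… n ] pointwise ⟩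
    (∑[ p ∈ [0… n ] ] 𝟙 (i ≤ᵇ d ∸ 2) * (𝟙 (suc a ≤ᵇ p) * 𝟙 (D p i)))
      ≡⟨ *-distribˡ-∑ (𝟙 (i ≤ᵇ d ∸ 2)) [0… n ] (λ p → 𝟙 (suc a ≤ᵇ p) * 𝟙 (D p i)) ⟨
    𝟙 (i ≤ᵇ d ∸ 2) * (∑[ p ∈ [0… n ] ] 𝟙 (suc a ≤ᵇ p) * 𝟙 (D p i))
      ≡⟨ cong (𝟙 (i ≤ᵇ d ∸ 2) *_) (∑from-[0…] n a (λ p → 𝟙 (D p i))) ⟩
    𝟙 (i ≤ᵇ d ∸ 2) * colTail n D i (suc a)
      ∎
    where
    pointwise : ∀ p → 𝟙 (D p i ∧ (suc a ≤ᵇ p) ∧ (1 ≤ᵇ i) ∧ (i ≤ᵇ d ∸ 2))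
                      ≡ 𝟙 (i ≤ᵇ d ∸ 2) * (𝟙 (suc a ≤ᵇ p) * 𝟙 (D p i))
    pointwise p = begin
      𝟙 (D p i ∧ (suc a ≤ᵇ p) ∧ (1 ≤ᵇ i) ∧ (i ≤ᵇ d ∸ 2))
        ≡⟨ cong (λ t → 𝟙 (D p i ∧ (suc a ≤ᵇ p) ∧ t ∧ (i ≤ᵇ d ∸ 2))) (≤ᵇ-true 1≤i) ⟩
      𝟙 (D p i ∧ (suc a ≤ᵇ p) ∧ (i ≤ᵇ d ∸ 2))
        ≡⟨ 𝟙-∧³ (D p i) (suc a ≤ᵇ p) (i ≤ᵇ d ∸ 2) ⟩
      𝟙 (D p i) * (𝟙 (suc a ≤ᵇ p) * 𝟙 (i ≤ᵇ d ∸ 2))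
        ≡⟨ *-CS.x∙yz≈z∙yx (𝟙 (D p i)) (𝟙 (suc a ≤ᵇ p)) (𝟙 (i ≤ᵇ d ∸ 2)) ⟩
      𝟙 (i ≤ᵇ d ∸ 2) * (𝟙 (suc a ≤ᵇ p) * 𝟙 (D p i))
        ∎

  module StandardFormCounts {n d a b : ℕ} {D : Subset²} (F : IsFerrers n D) (SF : StandardForm n D d a b) where

    d∸1≤a : d ∸ 1 ≤ a
    d∸1≤a = proj₁ SF

    d∸1≤b : d ∸ 1 ≤ b
    d∸1≤b = proj₁ (proj₂ SF)

    private
      corner : D a b ≡ true × ((d ∸ 1 ≤ a × a ≤ n) × (d ∸ 1 ≤ b × b ≤ n))
      corner = Equivalence.from (proj₂ (proj₂ SF) a b) ((d∸1≤a , ≤-refl) , (d∸1≤b , ≤-refl))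

    a≤n : a ≤ n
    a≤n = proj₂ (proj₁ (proj₂ corner))

    b≤n : b ≤ n
    b≤n = proj₂ (proj₂ (proj₂ corner))

    rectangle-full : ∀ {x y} → 1 ≤ x → x ≤ a → 1 ≤ y → y ≤ b → D x y ≡ true
    rectangle-full {x} {y} = proj₂ F a b x y (proj₁ corner)

    rectangle-bounded : ∀ {x y} → D x y ≡ true → d ∸ 1 ≤ x → x ≤ n → d ∸ 1 ≤ y → y ≤ n → x ≤ a × y ≤ b
    rectangle-bounded {x} {y} Dxy d∸1≤x x≤n d∸1≤y y≤n =
      let ((_ , x≤a) , (_ , y≤b)) = Equivalence.to (proj₂ (proj₂ SF) x y) (Dxy , (d∸1≤x , x≤n) , (d∸1≤y , y≤n))
      in x≤a , y≤b

    rowTail-beyond : ∀ {x} → d ∸ 1 ≤ x → x ≤ n → rowTail n D x (suc b) ≡ 0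
    rowTail-beyond d∸1≤x x≤n = ∑from-vanish n _ λ y b<y y≤n →
      𝟙-false λ Dxy → <⇒≱ b<y (proj₂ (rectangle-bounded Dxy d∸1≤x x≤n (≤-trans d∸1≤b (<⇒≤ b<y)) y≤n))

    colTail-beyond : ∀ {y} → d ∸ 1 ≤ y → y ≤ n → colTail n D y (suc a) ≡ 0
    colTail-beyond d∸1≤y y≤n = ∑from-vanish n _ λ x a<x x≤n →
      𝟙-false λ Dxy → <⇒≱ a<x (proj₁ (rectangle-bounded Dxy (≤-trans d∸1≤a (<⇒≤ a<x)) x≤n d∸1≤y y≤n))

    rowTail-Xset : ∀ {x i} → 1 ≤ x → x ≤ a → i ≤ b → rowTail n D x (suc i) ≡ (b ∸ i) + c n x (Xset D d b)
    rowTail-Xset {x} {i} 1≤x x≤a i≤b = begin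
      rowTail n D x (suc i)
        ≡⟨ ∑from-run n _ i≤b b≤n (λ y i<y y≤b → cong 𝟙 (rectangle-full 1≤x x≤a (≤-trans (s≤s z≤n) i<y) y≤b)) ⟩
      (b ∸ i) + rowTail n D x (suc b)
        ≡⟨ cong ((b ∸ i) +_) (𝟙-≤ᵇ-mask _ (λ x≰d∸2 → rowTail-beyond (m∸2<n⇒m∸1≤n d (≰⇒> x≰d∸2)) x≤n)) ⟩
      (b ∸ i) + 𝟙 (x ≤ᵇ d ∸ 2) * rowTail n D x (suc b)
        ≡⟨ cong ((b ∸ i) +_) (c-Xset n D {d} 1≤x) ⟨
      (b ∸ i) + c n x (Xset D d b)
        ∎
      where
      x≤n : x ≤ n
      x≤n = ≤-trans x≤a a≤n

    colTail-Yset : ∀ {y r} → 1 ≤ y → y ≤ b → r ≤ a → colTail n D y (suc r) ≡ (a ∸ r) + c n y (Yset D d a)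
    colTail-Yset {y} {r} 1≤y y≤b r≤a = begin
      colTail n D y (suc r)
        ≡⟨ ∑from-run n _ r≤a a≤n (λ x r<x x≤a → cong 𝟙 (rectangle-full (≤-trans (s≤s z≤n) r<x) x≤a 1≤y y≤b)) ⟩
      (a ∸ r) + colTail n D y (suc a)
        ≡⟨ cong ((a ∸ r) +_) (𝟙-≤ᵇ-mask _ (λ y≰d∸2 → colTail-beyond (m∸2<n⇒m∸1≤n d (≰⇒> y≰d∸2)) y≤n)) ⟩
      (a ∸ r) + 𝟙 (y ≤ᵇ d ∸ 2) * colTail n D y (suc a)
        ≡⟨ cong ((a ∸ r) +_) (c-Yset n D {d} 1≤y) ⟨
      (a ∸ r) + c n y (Yset D d a)
        ∎
      where
      y≤n : y ≤ n
      y≤n = ≤-trans y≤b b≤n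

    ν-step : ∀ {i} → 1 ≤ i → i ≤ d ∸ 1 →
      ν n D d i + ((a ∸ (d ∸ i)) + c n i (Yset D d a)) ≡ ν n D d (i ∸ 1) + ((b ∸ i) + c n (d ∸ i) (Xset D d b))
    ν-step {suc k} 1≤i i≤d∸1 = begin
      ν n D d i + ((a ∸ r) + c n i (Yset D d a))
        ≡⟨ cong₂ _+_ (ν≡quadrant n D d i) (sym (colTail-Yset 1≤i i≤b r≤a)) ⟩
      quadrant n D r (suc i) + colTail n D i (suc r)
        ≡⟨ quadrant-corner n D 1≤r (≤-trans r≤a a≤n) 1≤i (≤-trans i≤b b≤n) ⟩
      quadrant n D (suc r) i + rowTail n D r (suc i)
        ≡⟨ cong₂ _+_ ν-previous (rowTail-Xset 1≤r r≤a i≤b) ⟩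
      ν n D d k + ((b ∸ i) + c n r (Xset D d b))
        ∎
      where
      i r : ℕ
      i = suc k
      r = d ∸ i
      i<d : i < d
      i<d = m≤n∸1⇒m<n 1≤i i≤d∸1
      1≤r : 1 ≤ r
      1≤r = m<n⇒0<n∸m i<d
      r≤a : r ≤ a
      r≤a = ≤-trans (∸-monoʳ-≤ d 1≤i) d∸1≤a
      i≤b : i ≤ b
      i≤b = ≤-trans i≤d∸1 d∸1≤b
      ν-previous : quadrant n D (suc r) i ≡ ν n D d k
      ν-previous = sym (trans (ν≡quadrant n D d k) (cong (λ t → quadrant n D t i) (+-∸-assoc 1 (<⇒≤ i<d))))

module Differences where
  open import Data.Nat as ℕ using (ℕ; _≤_; _∸_; suc; zero; z≤n; s≤s)
  open import Data.Nat.Properties using (m∸n+n≡m; ≤-trans; n≤1+n)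
  open import Data.Integer using (ℤ; +_; _+_; _-_; _*_)
  open import Data.Integer.Properties using (pos-+)
  open import Data.Integer.Tactic.RingSolver using (solve; solve-∀)
  open Counting using (∑; ∑-[suc])
  open ≡-Reasoning

  balance⇒difference : ∀ p q A B X Y r i {a b d : ℤ} → p + (A + Y) ≡ q + (B + X) →
    a ≡ A + r → b ≡ B + i → d ≡ r + i → p - q ≡ b - a + d - + 2 * i + X - Y
  balance⇒difference p q A B X Y r i balance refl refl refl = begin
    p - q                                  ≡⟨ solve (p ∷ q ∷ A ∷ Y ∷ []) ⟩
    p + (A + Y) - q - (A + Y)              ≡⟨ cong (λ t → t - q - (A + Y)) balance ⟩
    q + (B + X) - q - (A + Y)              ≡⟨ solve (q ∷ A ∷ B ∷ X ∷ Y ∷ r ∷ i ∷ []) ⟩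
    B + i - (A + r) + (r + i) - + 2 * i + X - Y ∎

  step-difference : ∀ p q {a b d i X Y : ℕ} → i ≤ b → d ∸ i ≤ a → i ≤ d →
    p ℕ.+ ((a ∸ (d ∸ i)) ℕ.+ Y) ≡ q ℕ.+ ((b ∸ i) ℕ.+ X) →
    + p - + q ≡ + b - + a + + d - + 2 * + i + + X - + Y
  step-difference p q {a} {b} {d} {i} {X} {Y} i≤b d∸i≤a i≤d balance =
    balance⇒difference (+ p) (+ q) (+ (a ∸ (d ∸ i))) (+ (b ∸ i)) (+ X) (+ Y) (+ (d ∸ i)) (+ i)
                       (trans (sym (pos-+³ p _ Y)) (trans (cong +_ balance) (pos-+³ q _ X)))
                       (split d∸i≤a) (split i≤b) (split i≤d)
    where
    pos-+³ : ∀ u v w → + (u ℕ.+ (v ℕ.+ w)) ≡ + u + (+ v + + w)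
    pos-+³ u v w = trans (pos-+ u (v ℕ.+ w)) (cong (λ t → + u + t) (pos-+ v w))
    split : ∀ {m k} → k ≤ m → + m ≡ + (m ∸ k) + + k
    split {m} {k} k≤m = trans (cong +_ (sym (m∸n+n≡m k≤m))) (pos-+ (m ∸ k) k)

  telescope-step : ∀ u v w K J X Y SX SY {J′ SX′ SY′ : ℤ} → J′ ≡ + 1 + J → SX′ ≡ SX + X → SY′ ≡ SY + Y →
    u - v ≡ K - + 2 * J′ + X - Y → v - w ≡ J * (K - + 1 - J) + SX - SY →
    u - w ≡ J′ * (K - + 1 - J′) + SX′ - SY′
  telescope-step u v w K J X Y SX SY refl refl refl step₁ step₂ = begin
    u - w                                                       ≡⟨ solve (u ∷ v ∷ w ∷ []) ⟩
    (u - v) + (v - w)                                           ≡⟨ cong₂ _+_ step₁ step₂ ⟩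
    (K - + 2 * (+ 1 + J) + X - Y) + (J * (K - + 1 - J) + SX - SY) ≡⟨ solve (K ∷ J ∷ X ∷ Y ∷ SX ∷ SY ∷ []) ⟩
    (+ 1 + J) * (K - + 1 - (+ 1 + J)) + (SX + X) - (SY + Y)     ∎

  telescope : ∀ (K : ℤ) (f x y : ℕ → ℕ) m →
    (∀ i → 1 ≤ i → i ≤ m → + f i - + f (i ∸ 1) ≡ K - + 2 * + i + + x i - + y i) →
    ∀ j → j ≤ m → + f j - + f 0 ≡ + j * (K - + 1 - + j) + + ∑ [ j ] x - + ∑ [ j ] y
  telescope K f x y m step zero    _      = base (+ f 0) (K - + 1 - + 0)
    where
    base : ∀ u L → u - u ≡ + 0 * L + + 0 - + 0
    base = solve-∀
  telescope K f x y m step (suc j) 1+j≤m =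
    telescope-step (+ f (suc j)) (+ f j) (+ f 0) K (+ j) (+ x (suc j)) (+ y (suc j)) (+ ∑ [ j ] x) (+ ∑ [ j ] y)
                   (pos-+ 1 j) (∑-[suc]-ℤ x) (∑-[suc]-ℤ y)
                   (step (suc j) (s≤s z≤n) 1+j≤m) (telescope K f x y m step j (≤-trans (n≤1+n j) 1+j≤m))
    where
    ∑-[suc]-ℤ : ∀ g → + ∑ [ suc j ] g ≡ + ∑ [ j ] g + + g (suc j)
    ∑-[suc]-ℤ g = trans (cong +_ (∑-[suc] j g)) (pos-+ (∑ [ j ] g) (g (suc j)))

open import Data.Nat using (ℕ; _≤_; _∸_)
open import Data.Nat.Properties using (≤-trans; <⇒≤; ∸-monoʳ-≤)
open import Data.Integer using (ℤ; +_; _+_; _-_; _*_)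
open Counting using (m≤n∸1⇒m<n; module StandardFormCounts)
open Differences using (step-difference; telescope)

proposition4p11 : (n d a b : ℕ) (D : Subset²) → 1 ≤ d → IsFerrers n D → MeetsB n D d → StandardForm n D d a b →
    ((i : ℕ) → 1 ≤ i → i ≤ d ∸ 1 →
      (+ ν n D d i) - (+ ν n D d (i ∸ 1))
        ≡ (+ b) - (+ a) + (+ d) - (+ 2) * (+ i) + (+ c n (d ∸ i) (Xset D d b)) - (+ c n i (Yset D d a)))
    × ((j : ℕ) → 1 ≤ j → j ≤ d ∸ 1 →
      (+ ν n D d j) - (+ ν n D d 0)
        ≡ (+ j) * ((+ b) - (+ a) + (+ d) - (+ 1) - (+ j))
          + (+ sum (map (λ i → c n (d ∸ i) (Xset D d b)) [ j ]))
          - (+ sum (map (λ i → c n i (Yset D d a)) [ j ])))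
proposition4p11 n d a b D _ F _ SF = ν-difference , λ j _ → telescope K (ν n D d) cX cY (d ∸ 1) ν-difference j
  where
  open StandardFormCounts {d = d} F SF
  K : ℤ
  K = + b - + a + + d
  cX cY : ℕ → ℕ
  cX i = c n (d ∸ i) (Xset D d b)
  cY i = c n i (Yset D d a)
  ν-difference : (i : ℕ) → 1 ≤ i → i ≤ d ∸ 1 → + ν n D d i - + ν n D d (i ∸ 1) ≡ K - + 2 * + i + + cX i - + cY i
  ν-difference i 1≤i i≤d∸1 =
    step-difference (ν n D d i) (ν n D d (i ∸ 1))
      (≤-trans i≤d∸1 d∸1≤b) (≤-trans (∸-monoʳ-≤ d 1≤i) d∸1≤a) (<⇒≤ (m≤n∸1⇒m<n 1≤i i≤d∸1)) (ν-step 1≤i i≤d∸1)
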